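{- Let $\mathcal{C}$ be a category with finite products and weak equalisers in which every object is a choice object. Let $a,b\in\mathrm{Presub}(X)$, $f,g\colon Y\to X$ and $r\in\mathrm{Presub}(X\times Y)$. Then: (1) for $y\in Y$: $y\in_{f^*a}$ iff $fy\in_a$; (2) for $y\in Y$: $y\in_{(f\doteq g)}$ iff $fy=gy$; (3) for $x\in X$: $x\in_{a\wedge b}$ iff $x\in_a$ and $x\in_b$; (4) for $x\in X$: $x\in_{\exists_Y r}$ iff there is $y\in Y$ with $\langle x,y\rangle\in_r$. Moreover, each of $f^*a$, $f\doteq g$, $a\wedge b$, $\exists_Y r$ is the unique presubobject satisfying the corresponding condition for all elements: e.g. if $c\in\mathrm{Presub}(X)$ satisfies, for all $x\in X$, $x\in_c$ iff ($x\in_a$ and $x\in_b$), then $c=a\wedge b$, and similarly for the other three.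
   Context: Global elements $x\colon1\to X$ are written $x\in X$; for an arrow $a\colon A\to X$, $x\in_a$ means there is $u\in A$ with $au=x$; surjective means $x\in_a$ for all $x\in X$; an object is a choice object if every surjection onto it has a section. For arrows $a\colon A\to X$, $b\colon B\to X$, $a\le b$ means $bh=a$ for some $h$; $\mathrm{Presub}(X)$ is the poset reflection of this preorder on arrows with codomain $X$ (its elements are called presubobjects; $x\in_a$ depends only on the presubobject of $a$). The operations are defined using weak limits (limits without uniqueness of mediating arrows), and are well defined on presubobjects: $f^*a\in\mathrm{Presub}(Y)$ is represented by the arrow $P\to Y$ of a weak pullback of a representative of $a$ along $f$; $(f\doteq g)\in\mathrm{Presub}(Y)$ is represented by a weak equaliser of $f,g$; $a\wedge b\in\mathrm{Presub}(X)$ is represented by the composite $P\to A\to X$ where $P$ is a weak pullback of representatives $A\to X$, $B\to X$; $\exists_Y r\in\mathrm{Presub}(X)$ is represented by $\pi_1\circ r$ where $r\colon R\to X\times Y$ is a representative. -}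

module Defs where

open import Level using (Level; _⊔_; suc)
open import Data.Product using (Σ; Σ-syntax; _×_; _,_)
open import Relation.Binary.PropositionalEquality using (_≡_)

record Category (o ℓ : Level) : Set (suc (o ⊔ ℓ)) where
  infixr 9 _∘_
  field
    Obj  : Set o
    Hom  : Obj → Obj → Set ℓ
    id   : ∀ {A} → Hom A A
    _∘_  : ∀ {A B C} → Hom B C → Hom A B → Hom A C
    identityˡ : ∀ {A B} {f : Hom A B} → id ∘ f ≡ f
    identityʳ : ∀ {A B} {f : Hom A B} → f ∘ id ≡ f
    assoc : ∀ {A B C D} {f : Hom A B} {g : Hom B C} {h : Hom C D} →
            (h ∘ g) ∘ f ≡ h ∘ (g ∘ f)

module _ {o ℓ : Level} (C : Category o ℓ) where
  open Category C

  record Terminal : Set (o ⊔ ℓ) where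
    field
      ⊤ : Obj
      ! : ∀ {A} → Hom A ⊤
      !-unique : ∀ {A} (h : Hom A ⊤) → h ≡ !

  record Product (A B : Obj) : Set (o ⊔ ℓ) where
    field
      A×B : Obj
      π₁ : Hom A×B A
      π₂ : Hom A×B B
      ⟨_,_⟩ : ∀ {Z} → Hom Z A → Hom Z B → Hom Z A×B
      project₁ : ∀ {Z} {f : Hom Z A} {g : Hom Z B} → π₁ ∘ ⟨ f , g ⟩ ≡ f
      project₂ : ∀ {Z} {f : Hom Z A} {g : Hom Z B} → π₂ ∘ ⟨ f , g ⟩ ≡ g
      unique : ∀ {Z} {f : Hom Z A} {g : Hom Z B} (h : Hom Z A×B) →
               π₁ ∘ h ≡ f → π₂ ∘ h ≡ g → h ≡ ⟨ f , g ⟩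

  BinaryProducts : Set (o ⊔ ℓ)
  BinaryProducts = ∀ (A B : Obj) → Product A B

  record IsWeakEqualiser {A B E : Obj} (f g : Hom A B) (e : Hom E A) : Set (o ⊔ ℓ) where
    field
      equality : f ∘ e ≡ g ∘ e
      universal : ∀ {Z} (h : Hom Z A) → f ∘ h ≡ g ∘ h → Σ[ k ∈ Hom Z E ] e ∘ k ≡ h

  HasWeakEqualisers : Set (o ⊔ ℓ)
  HasWeakEqualisers = ∀ {A B : Obj} (f g : Hom A B) →
    Σ[ E ∈ Obj ] Σ[ e ∈ Hom E A ] IsWeakEqualiser f g e

  record IsWeakPullback {A B X P : Obj} (a : Hom A X) (b : Hom B X)
                        (p₁ : Hom P A) (p₂ : Hom P B) : Set (o ⊔ ℓ) where
    field
      commute : a ∘ p₁ ≡ b ∘ p₂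
      universal : ∀ {Z} (h₁ : Hom Z A) (h₂ : Hom Z B) → a ∘ h₁ ≡ b ∘ h₂ →
                  Σ[ k ∈ Hom Z P ] (p₁ ∘ k ≡ h₁ × p₂ ∘ k ≡ h₂)

  _≤ₐ_ : ∀ {A B X : Obj} → Hom A X → Hom B X → Set ℓ
  _≤ₐ_ {A} {B} a b = Σ[ h ∈ Hom A B ] b ∘ h ≡ a

  -- equality in Presub(X) (the poset reflection) of the classes of a and b
  _≃ₚ_ : ∀ {A B X : Obj} → Hom A X → Hom B X → Set ℓ
  a ≃ₚ b = (a ≤ₐ b) × (b ≤ₐ a)

  module WithTerminal (T : Terminal) where
    open Terminal T

    _∈[_] : ∀ {A X : Obj} → Hom ⊤ X → Hom A X → Set ℓ
    _∈[_] {A} x a = Σ[ u ∈ Hom ⊤ A ] a ∘ u ≡ x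

    Surjective : ∀ {A X : Obj} → Hom A X → Set ℓ
    Surjective {X = X} a = ∀ (x : Hom ⊤ X) → x ∈[ a ]

    ChoiceObject : Obj → Set (o ⊔ ℓ)
    ChoiceObject X = ∀ {E : Obj} (e : Hom E X) → Surjective e →
                     Σ[ s ∈ Hom X E ] e ∘ s ≡ id

module Submission where

-- The uniqueness halves all rest on one fact (`elements⇒≤`): if the domain D
-- of c : D → X is a choice object and every element of c is an element of
-- b : B → X, then c ≤ b.  To see it, form a weak pullback (q₁, q₂) of b along
-- c (it exists since weak pullbacks are built from a product and a weak
-- equaliser).  By the membership property of pullbacks, d ∈ q₂ iff c d ∈ b,
-- which always holds; so q₂ is surjective, has a section s, and then
-- c = c q₂ s = b q₁ s.  Applying this in both directions, two presubobjects
-- with the same elements are equal, whence each of f*a, f ≐ g, a ∧ b and ∃_Y r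
-- is the unique presubobject with the prescribed elements.

open import Defs
open import Level using (Level)
open import Data.Product using (Σ; Σ-syntax; _×_; _,_)
open import Relation.Binary.PropositionalEquality
  using (_≡_; refl; sym; trans; cong; module ≡-Reasoning)
open import Function.Bundles using (_⇔_; mk⇔; Equivalence)

module ElementsOf {o ℓ : Level} (C : Category o ℓ) (T : Terminal C) where
  open Category C
  open Terminal T
  open WithTerminal C T
  open ≡-Reasoning

  square-∘ : ∀ {A B X Z W} {a : Hom A X} {b : Hom B X} {p : Hom Z A} {q : Hom Z B} →
             a ∘ p ≡ b ∘ q → (u : Hom W Z) → a ∘ (p ∘ u) ≡ b ∘ (q ∘ u)
  square-∘ {a = a} {b} {p} {q} sq u = begin
    a ∘ (p ∘ u)  ≡⟨ sym assoc ⟩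
    (a ∘ p) ∘ u  ≡⟨ cong (_∘ u) sq ⟩
    (b ∘ q) ∘ u  ≡⟨ assoc ⟩
    b ∘ (q ∘ u)  ∎

  ∈-∘ : ∀ {A P X} {a : Hom A X} {p : Hom P A} {x : Hom ⊤ X} → x ∈[ a ∘ p ] → x ∈[ a ]
  ∈-∘ {p = p} (u , apu≡x) = p ∘ u , trans (sym assoc) apu≡x

  pullback-elements : ∀ {A X Y P} (a : Hom A X) (f : Hom Y X) (p₁ : Hom P A) (p₂ : Hom P Y) →
    IsWeakPullback C a f p₁ p₂ → ∀ (y : Hom ⊤ Y) → (y ∈[ p₂ ]) ⇔ ((f ∘ y) ∈[ a ])
  pullback-elements a f p₁ p₂ W y = mk⇔ to from
    where
    module W = IsWeakPullback W
    to : y ∈[ p₂ ] → (f ∘ y) ∈[ a ]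
    to (u , p₂u≡y) = p₁ ∘ u , trans (square-∘ W.commute u) (cong (f ∘_) p₂u≡y)
    from : (f ∘ y) ∈[ a ] → y ∈[ p₂ ]
    from (u , au≡fy) with W.universal u y au≡fy
    ... | k , _ , p₂k≡y = k , p₂k≡y

  equaliser-elements : ∀ {X Y E} (f g : Hom Y X) (e : Hom E Y) →
    IsWeakEqualiser C f g e → ∀ (y : Hom ⊤ Y) → (y ∈[ e ]) ⇔ (f ∘ y ≡ g ∘ y)
  equaliser-elements f g e W y = mk⇔ to (W.universal y)
    where
    module W = IsWeakEqualiser W
    to : y ∈[ e ] → f ∘ y ≡ g ∘ y
    to (u , eu≡y) = begin
      f ∘ y        ≡⟨ cong (f ∘_) (sym eu≡y) ⟩
      f ∘ (e ∘ u)  ≡⟨ square-∘ W.equality u ⟩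
      g ∘ (e ∘ u)  ≡⟨ cong (g ∘_) eu≡y ⟩
      g ∘ y        ∎

  meet-elements : ∀ {A B X P} (a : Hom A X) (b : Hom B X) (p₁ : Hom P A) (p₂ : Hom P B) →
    IsWeakPullback C a b p₁ p₂ →
    ∀ (x : Hom ⊤ X) → (x ∈[ a ∘ p₁ ]) ⇔ ((x ∈[ a ]) × (x ∈[ b ]))
  meet-elements a b p₁ p₂ W x = mk⇔ to from
    where
    module W = IsWeakPullback W
    to : x ∈[ a ∘ p₁ ] → (x ∈[ a ]) × (x ∈[ b ])
    to (u , ap₁u≡x) = ∈-∘ (u , ap₁u≡x)
                    , p₂ ∘ u , trans (sym (square-∘ W.commute u)) (trans (sym assoc) ap₁u≡x)
    from : (x ∈[ a ]) × (x ∈[ b ]) → x ∈[ a ∘ p₁ ]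
    from ((u , au≡x) , (v , bv≡x)) with W.universal u v (trans au≡x (sym bv≡x))
    ... | k , p₁k≡u , _ = k , (begin
      (a ∘ p₁) ∘ k  ≡⟨ assoc ⟩
      a ∘ (p₁ ∘ k)  ≡⟨ cong (a ∘_) p₁k≡u ⟩
      a ∘ u         ≡⟨ au≡x ⟩
      x             ∎)

  image-elements : ∀ {X Y R} (XY : Product C X Y) →
    let open Product XY in
    ∀ (r : Hom R A×B) (x : Hom ⊤ X) →
    (x ∈[ π₁ ∘ r ]) ⇔ (Σ[ y ∈ Hom ⊤ Y ] (⟨ x , y ⟩ ∈[ r ]))
  image-elements XY r x = mk⇔ to from
    where
    open Product XY
    to : x ∈[ π₁ ∘ r ] → Σ[ y ∈ _ ] (⟨ x , y ⟩ ∈[ r ])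
    to (u , π₁ru≡x) = π₂ ∘ (r ∘ u) , u , unique (r ∘ u) (trans (sym assoc) π₁ru≡x) refl
    from : Σ[ y ∈ _ ] (⟨ x , y ⟩ ∈[ r ]) → x ∈[ π₁ ∘ r ]
    from (y , u , ru≡xy) = u , (begin
      (π₁ ∘ r) ∘ u   ≡⟨ assoc ⟩
      π₁ ∘ (r ∘ u)   ≡⟨ cong (π₁ ∘_) ru≡xy ⟩
      π₁ ∘ ⟨ x , y ⟩ ≡⟨ project₁ ⟩
      x              ∎)

  equaliser⇒weakPullback : ∀ {A B X E} (a : Hom A X) (b : Hom B X) (AB : Product C A B) →
    let open Product AB in
    (e : Hom E A×B) → IsWeakEqualiser C (a ∘ π₁) (b ∘ π₂) e →
    IsWeakPullback C a b (π₁ ∘ e) (π₂ ∘ e)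
  equaliser⇒weakPullback {A} {B} {E = E} a b AB e W = record
    { commute   = trans (sym assoc) (trans W.equality assoc)
    ; universal = universal
    }
    where
    open Product AB
    module W = IsWeakEqualiser W
    universal : ∀ {Z} (h₁ : Hom Z A) (h₂ : Hom Z B) → a ∘ h₁ ≡ b ∘ h₂ →
                Σ[ k ∈ Hom Z E ] ((π₁ ∘ e) ∘ k ≡ h₁ × (π₂ ∘ e) ∘ k ≡ h₂)
    universal h₁ h₂ ah₁≡bh₂ with W.universal ⟨ h₁ , h₂ ⟩ pair-equalises
      where
      pair-equalises : (a ∘ π₁) ∘ ⟨ h₁ , h₂ ⟩ ≡ (b ∘ π₂) ∘ ⟨ h₁ , h₂ ⟩
      pair-equalises = begin
        (a ∘ π₁) ∘ ⟨ h₁ , h₂ ⟩  ≡⟨ assoc ⟩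
        a ∘ (π₁ ∘ ⟨ h₁ , h₂ ⟩)  ≡⟨ cong (a ∘_) project₁ ⟩
        a ∘ h₁                  ≡⟨ ah₁≡bh₂ ⟩
        b ∘ h₂                  ≡⟨ cong (b ∘_) (sym project₂) ⟩
        b ∘ (π₂ ∘ ⟨ h₁ , h₂ ⟩)  ≡⟨ sym assoc ⟩
        (b ∘ π₂) ∘ ⟨ h₁ , h₂ ⟩  ∎
    ... | k , ek≡h₁h₂ = k , project-after π₁ project₁ , project-after π₂ project₂
      where
      project-after : ∀ {Y} (π : Hom A×B Y) {h : Hom _ Y} → π ∘ ⟨ h₁ , h₂ ⟩ ≡ h → (π ∘ e) ∘ k ≡ h
      project-after π πh≡h = trans assoc (trans (cong (π ∘_) ek≡h₁h₂) πh≡h)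

  weakPullback : BinaryProducts C → HasWeakEqualisers C →
    ∀ {A B X} (a : Hom A X) (b : Hom B X) →
    Σ[ P ∈ Obj ] Σ[ p₁ ∈ Hom P A ] Σ[ p₂ ∈ Hom P B ] IsWeakPullback C a b p₁ p₂
  weakPullback prod weq {A} {B} a b
    with weq (a ∘ Product.π₁ (prod A B)) (b ∘ Product.π₂ (prod A B))
  ... | E , e , W = E , π₁ ∘ e , π₂ ∘ e , equaliser⇒weakPullback a b (prod A B) e W
    where open Product (prod A B)

  -- The leg q₂ of a weak
  -- pullback of b along c is surjective by `pullback-elements`; a section of
  -- it factors c through b.
  elements⇒≤ : ∀ {D B X P} (c : Hom D X) (b : Hom B X) (q₁ : Hom P B) (q₂ : Hom P D) →
    IsWeakPullback C b c q₁ q₂ → ChoiceObject D →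
    (∀ (x : Hom ⊤ X) → x ∈[ c ] → x ∈[ b ]) → _≤ₐ_ C c b
  elements⇒≤ c b q₁ q₂ W choice c⊆b with choice q₂ q₂-surjective
    where
    q₂-surjective : Surjective q₂
    q₂-surjective d = Equivalence.from (pullback-elements b c q₁ q₂ W d) (c⊆b (c ∘ d) (d , refl))
  ... | s , q₂s≡id = q₁ ∘ s , (begin
    b ∘ (q₁ ∘ s)  ≡⟨ square-∘ (IsWeakPullback.commute W) s ⟩
    c ∘ (q₂ ∘ s)  ≡⟨ cong (c ∘_) q₂s≡id ⟩
    c ∘ id        ≡⟨ identityʳ ⟩
    c             ∎)

  elements⇒≃ₚ : BinaryProducts C → HasWeakEqualisers C →
    ∀ {D B X} {Φ : Hom ⊤ X → Set ℓ} (c : Hom D X) (b : Hom B X) →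
    ChoiceObject D → ChoiceObject B →
    (∀ x → (x ∈[ b ]) ⇔ Φ x) → (∀ x → (x ∈[ c ]) ⇔ Φ x) → _≃ₚ_ C c b
  elements⇒≃ₚ prod weq c b choiceD choiceB b⇔Φ c⇔Φ with weakPullback prod weq b c | weakPullback prod weq c b
  ... | _ , q₁ , q₂ , W | _ , q₁′ , q₂′ , W′ =
      elements⇒≤ c b q₁ q₂ W choiceD (λ x x∈c → Equivalence.from (b⇔Φ x) (Equivalence.to (c⇔Φ x) x∈c))
    , elements⇒≤ b c q₁′ q₂′ W′ choiceB (λ x x∈b → Equivalence.from (c⇔Φ x) (Equivalence.to (b⇔Φ x) x∈b))

corollary3p9 : ∀ {o ℓ : Level} (C : Category o ℓ) (T : Terminal C)
    (prod : BinaryProducts C) (weq : HasWeakEqualisers C) →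
    let open Category C
        open Terminal T
        open WithTerminal C T
    in (∀ (X : Obj) → ChoiceObject X) →
    -- (1) pullback f*a, represented by p₂ of any weak pullback of a along f
    (∀ {A X Y P : Obj} (a : Hom A X) (f : Hom Y X) (p₁ : Hom P A) (p₂ : Hom P Y) →
       IsWeakPullback C a f p₁ p₂ →
       (∀ (y : Hom ⊤ Y) → (y ∈[ p₂ ]) ⇔ ((f ∘ y) ∈[ a ]))
       × (∀ {D : Obj} (c : Hom D Y) →
            (∀ (y : Hom ⊤ Y) → (y ∈[ c ]) ⇔ ((f ∘ y) ∈[ a ])) →
            _≃ₚ_ C c p₂))
    ×
    -- (2) f ≐ g, represented by any weak equaliser e of f and g
    (∀ {X Y E : Obj} (f g : Hom Y X) (e : Hom E Y) →
       IsWeakEqualiser C f g e →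
       (∀ (y : Hom ⊤ Y) → (y ∈[ e ]) ⇔ (f ∘ y ≡ g ∘ y))
       × (∀ {D : Obj} (c : Hom D Y) →
            (∀ (y : Hom ⊤ Y) → (y ∈[ c ]) ⇔ (f ∘ y ≡ g ∘ y)) →
            _≃ₚ_ C c e))
    ×
    -- (3) a ∧ b, represented by a ∘ p₁ for any weak pullback (p₁, p₂) of a and b
    (∀ {A B X P : Obj} (a : Hom A X) (b : Hom B X) (p₁ : Hom P A) (p₂ : Hom P B) →
       IsWeakPullback C a b p₁ p₂ →
       (∀ (x : Hom ⊤ X) → (x ∈[ a ∘ p₁ ]) ⇔ ((x ∈[ a ]) × (x ∈[ b ])))
       × (∀ {D : Obj} (c : Hom D X) →
            (∀ (x : Hom ⊤ X) → (x ∈[ c ]) ⇔ ((x ∈[ a ]) × (x ∈[ b ]))) →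
            _≃ₚ_ C c (a ∘ p₁)))
    ×
    -- (4) ∃_Y r, represented by π₁ ∘ r for r : R → X × Y
    (∀ {X Y R : Obj} →
       let open Product (prod X Y) in
       ∀ (r : Hom R A×B) →
       (∀ (x : Hom ⊤ X) → (x ∈[ π₁ ∘ r ]) ⇔ (Σ[ y ∈ Hom ⊤ Y ] (⟨ x , y ⟩ ∈[ r ])))
       × (∀ {D : Obj} (c : Hom D X) →
            (∀ (x : Hom ⊤ X) → (x ∈[ c ]) ⇔ (Σ[ y ∈ Hom ⊤ Y ] (⟨ x , y ⟩ ∈[ r ]))) →
            _≃ₚ_ C c (π₁ ∘ r)))
corollary3p9 {ℓ = ℓ} C T prod weq choice =
    (λ a f p₁ p₂ W → characterised (pullback-elements a f p₁ p₂ W))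
  , (λ f g e W → characterised (equaliser-elements f g e W))
  , (λ a b p₁ p₂ W → characterised (meet-elements a b p₁ p₂ W))
  , (λ {X} {Y} r → characterised (image-elements (prod X Y) r))
  where
  open Category C
  open WithTerminal C T
  open ElementsOf C T

  characterised : ∀ {B X} {b : Hom B X} {Φ : Hom (Terminal.⊤ T) X → Set ℓ} →
    (∀ x → (x ∈[ b ]) ⇔ Φ x) →
    (∀ x → (x ∈[ b ]) ⇔ Φ x) ×
    (∀ {D} (c : Hom D X) → (∀ x → (x ∈[ c ]) ⇔ Φ x) → _≃ₚ_ C c b)
  characterised {B} {b = b} b⇔Φ =
    b⇔Φ , λ {D} c c⇔Φ → elements⇒≃ₚ prod weq c b (choice D) (choice B) b⇔Φ c⇔Φ
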